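{- Let $K$ be an imaginary quadratic field with ring of integers $\mathcal{O}_K$, let $f$ be a positive integer, and let $\mathcal{L}_f$ be the set of primeval lattices for the order $\mathcal{O}_f$, i.e. rank two $\mathbb{Z}$-lattices $\Lambda\subseteq\mathcal{O}_K$ with $\mathrm{Ord}(\Lambda)=\mathcal{O}_f$ which have a $\mathbb{Z}$-basis of two coprime elements. Then there is a bijection \[ \mathcal{L}_f\longrightarrow(\mathcal{O}_K/f\mathcal{O}_K)^*/(\mathbb{Z}/f\mathbb{Z})^*, \] obtained by reducing $\Lambda$ modulo $f\mathcal{O}_K$ and taking the indicated quotients, whose inverse is given by $\beta\mapsto f\mathcal{O}_K+\beta\mathbb{Z}$.
   Context: $\mathcal{O}_f=\mathbb{Z}+f\mathcal{O}_K$ is the order of conductor $f$. For a lattice $\Lambda\subseteq\mathcal{O}_K$, $\mathrm{Ord}(\Lambda)=\{\alpha\in\mathcal{O}_K:\alpha\Lambda\subseteq\Lambda\}$. Elements $\beta,\delta\in\mathcal{O}_K$ are coprime if $(\beta)+(\delta)=\mathcal{O}_K$. $(\mathbb{Z}/f\mathbb{Z})^*$ is regarded as a subgroup of $(\mathcal{O}_K/f\mathcal{O}_K)^*$. -}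

module Defs where

open import Level using (0ℓ; Level) renaming (suc to lsuc)
open import Data.Nat using (ℕ)
open import Data.Integer using (ℤ; +_; _+_; _-_; _*_; -_; 0ℤ; 1ℤ; _<_)
open import Data.Integer.Divisibility.Signed using (_∣_; divides; ∣m∣n⇒∣m+n; ∣n⇒∣m*n; ∣m⇒∣-m; ∣m∣n⇒∣m-n)
open import Data.Integer.Tactic.RingSolver using (solve-∀)
open import Data.Product using (Σ; Σ-syntax; ∃; ∃-syntax; _×_; _,_; proj₁; proj₂)
open import Data.Sum using (_⊎_)
open import Relation.Unary using (Pred)
open import Relation.Binary.PropositionalEquality using (_≡_; refl; subst; sym)
open import Relation.Binary.Bundles using (Setoid)
open import Relation.Binary.Structures using (IsEquivalence)

infix 4 _≡_[modℤ_] _≡ᴷ_[mod_] _≐_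
infixl 6 _+K_
infixl 7 _·_

_≡_[modℤ_] : ℤ → ℤ → ℤ → Set
x ≡ y [modℤ m ] = m ∣ (x - y)

Squarefree : ℤ → Set
Squarefree m = (p : ℤ) → (p * p) ∣ m → p ∣ 1ℤ

IsFundamentalDiscriminant : ℤ → Set
IsFundamentalDiscriminant D =
  (D ≡ 1ℤ [modℤ + 4 ] × Squarefree D)
  ⊎ (Σ[ m ∈ ℤ ] (D ≡ + 4 * m) × (m ≡ + 2 [modℤ + 4 ] ⊎ m ≡ + 3 [modℤ + 4 ]) × Squarefree m)

-- The ring of integers O_K = ℤ[ω], where ω² = t ω - n and t² - 4n = D
-- is the (negative, fundamental) discriminant of K.
-- An element (a , b) stands for a + b ω.

record OK : Set where
  constructor _+_ω
  field
    re : ℤ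
    im : ℤ
open OK public

oneK : OK
oneK = 1ℤ + 0ℤ ω

zeroK : OK
zeroK = 0ℤ + 0ℤ ω

_+K_ : OK → OK → OK
(a + b ω) +K (c + d ω) = (a + c) + (b + d) ω

_·_ : ℤ → OK → OK
m · (a + b ω) = (m * a) + (m * b) ω

mulK : (t n : ℤ) → OK → OK → OK
mulK t n (a + b ω) (c + d ω) = (a * c - b * d * n) + (a * d + b * c + b * d * t) ω

-- congruence modulo f O_K (f a positive integer): componentwise mod f
_≡ᴷ_[mod_] : OK → OK → ℕ → Set
x ≡ᴷ y [mod f ] = (re x ≡ re y [modℤ + f ]) × (im x ≡ im y [modℤ + f ])

-- the order O_f = ℤ + f O_K
InOrder : ℕ → OK → Set
InOrder f α = (+ f) ∣ im α

Coprime : (t n : ℤ) → OK → OK → Set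
Coprime t n β δ = Σ[ x ∈ OK ] Σ[ y ∈ OK ] (mulK t n x β +K mulK t n y δ ≡ oneK)

Subset : Set₁
Subset = Pred OK 0ℓ

_≐_ : Subset → Subset → Set
Λ ≐ Λ' = (x : OK) → (Λ x → Λ' x) × (Λ' x → Λ x)

LinIndep : OK → OK → Set
LinIndep e₁ e₂ = (a b : ℤ) → (a · e₁) +K (b · e₂) ≡ zeroK → (a ≡ 0ℤ) × (b ≡ 0ℤ)

IsBasis : Subset → OK → OK → Set
IsBasis Λ e₁ e₂ = LinIndep e₁ e₂ × ((x : OK) → (Λ x → Σ[ a ∈ ℤ ] Σ[ b ∈ ℤ ] x ≡ (a · e₁) +K (b · e₂))
                                             × (Σ[ a ∈ ℤ ] Σ[ b ∈ ℤ ] x ≡ (a · e₁) +K (b · e₂) → Λ x))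

OrdIs : (t n : ℤ) → ℕ → Subset → Set
OrdIs t n f Λ = (α : OK) → (((x : OK) → Λ x → Λ (mulK t n α x)) → InOrder f α)
                         × (InOrder f α → (x : OK) → Λ x → Λ (mulK t n α x))

Primeval : (t n : ℤ) → ℕ → Subset → Set
Primeval t n f Λ = (Σ[ e₁ ∈ OK ] Σ[ e₂ ∈ OK ] IsBasis Λ e₁ e₂ × Coprime t n e₁ e₂) × OrdIs t n f Λ

PrimevalLattice : (t n : ℤ) → ℕ → Set₁
PrimevalLattice t n f = Σ Subset (Primeval t n f)

LatticeSetoid : (t n : ℤ) → ℕ → Setoid (lsuc 0ℓ) 0ℓ
LatticeSetoid t n f = record
  { Carrier = PrimevalLattice t n f
  ; _≈_ = λ Λ Λ' → proj₁ Λ ≐ proj₁ Λ'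
  ; isEquivalence = record
    { refl = λ x → (λ p → p) , (λ p → p)
    ; sym = λ e x → proj₂ (e x) , proj₁ (e x)
    ; trans = λ e e' x → (λ p → proj₁ (e' x) (proj₁ (e x) p)) , (λ p → proj₂ (e x) (proj₂ (e' x) p))
    }
  }

IsUnitℤ : ℕ → ℤ → Set
IsUnitℤ f u = Σ[ v ∈ ℤ ] (u * v ≡ 1ℤ [modℤ + f ])

IsUnitMod : (t n : ℤ) → ℕ → OK → Set
IsUnitMod t n f β = Σ[ γ ∈ OK ] (mulK t n β γ ≡ᴷ oneK [mod f ])

UnitMod : (t n : ℤ) → ℕ → Set
UnitMod t n f = Σ OK (IsUnitMod t n f)

_~[_]_ : OK → ℕ → OK → Set
β ~[ f ] β' = Σ[ u ∈ ℤ ] IsUnitℤ f u × (β' ≡ᴷ u · β [mod f ])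

private
  cong-sym : ∀ (k u v x y : ℤ) → k ∣ (y - u * x) → k ∣ (u * v - 1ℤ) → k ∣ (x - v * y)
  cong-sym k u v x y p q = subst (k ∣_) (eq u v x y) (∣m∣n⇒∣m-n (∣m⇒∣-m (∣n⇒∣m*n v p)) (∣n⇒∣m*n x q))
    where
    eq : ∀ u v x y → (- (v * (y - u * x))) - x * (u * v - 1ℤ) ≡ x - v * y
    eq = solve-∀

  cong-trans : ∀ (k u u' x y z : ℤ) → k ∣ (y - u * x) → k ∣ (z - u' * y) → k ∣ (z - (u' * u) * x)
  cong-trans k u u' x y z p q = subst (k ∣_) (eq u u' x y z) (∣m∣n⇒∣m+n q (∣n⇒∣m*n u' p))
    where
    eq : ∀ u u' x y z → (z - u' * y) + u' * (y - u * x) ≡ z - (u' * u) * x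
    eq = solve-∀

  unit-mul : ∀ (k u v u' v' : ℤ) → k ∣ (u * v - 1ℤ) → k ∣ (u' * v' - 1ℤ) → k ∣ ((u' * u) * (v * v') - 1ℤ)
  unit-mul k u v u' v' p q = subst (k ∣_) (eq u v u' v') (∣m∣n⇒∣m+n (∣n⇒∣m*n (u' * v') p) q)
    where
    eq : ∀ u v u' v' → (u' * v') * (u * v - 1ℤ) + (u' * v' - 1ℤ) ≡ (u' * u) * (v * v') - 1ℤ
    eq = solve-∀

  unit-sym : ∀ (k u v : ℤ) → k ∣ (u * v - 1ℤ) → k ∣ (v * u - 1ℤ)
  unit-sym k u v p = subst (k ∣_) (eq u v) p
    where
    eq : ∀ u v → u * v - 1ℤ ≡ v * u - 1ℤ
    eq = solve-∀

  one-refl : ∀ (k x : ℤ) → k ∣ (x - 1ℤ * x)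
  one-refl k x = subst (k ∣_) (eq x) (divides 0ℤ (eq' k))
    where
    eq : ∀ x → 0ℤ ≡ x - 1ℤ * x
    eq = solve-∀
    eq' : ∀ k → 0ℤ ≡ 0ℤ * k
    eq' = solve-∀

  one-unit : ∀ (k : ℤ) → k ∣ (1ℤ * 1ℤ - 1ℤ)
  one-unit k = divides 0ℤ (eq k)
    where
    eq : ∀ k → 1ℤ * 1ℤ - 1ℤ ≡ 0ℤ * k
    eq = solve-∀

~-isEquivalence : (f : ℕ) → IsEquivalence (_~[ f ]_)
~-isEquivalence f = record
  { refl = λ {β} → 1ℤ , (1ℤ , one-unit (+ f)) , one-refl (+ f) (re β) , one-refl (+ f) (im β)
  ; sym = λ { {β} {β'} (u , (v , uv) , p , q) →
      v , (u , unit-sym (+ f) u v uv) , cong-sym (+ f) u v (re β) (re β') p uv , cong-sym (+ f) u v (im β) (im β') q uv }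
  ; trans = λ { {β} {β'} {β''} (u , (v , uv) , p , q) (u' , (v' , uv') , p' , q') →
      u' * u , (v * v' , unit-mul (+ f) u v u' v' uv uv')
             , cong-trans (+ f) u u' (re β) (re β') (re β'') p p'
             , cong-trans (+ f) u u' (im β) (im β') (im β'') q q' }
  }

UnitQuotSetoid : (t n : ℤ) → ℕ → Setoid 0ℓ 0ℓ
UnitQuotSetoid t n f = record
  { Carrier = UnitMod t n f
  ; _≈_ = λ β β' → proj₁ β ~[ f ] proj₁ β'
  ; isEquivalence = record
    { refl = λ {β} → IsEquivalence.refl (~-isEquivalence f) {proj₁ β}
    ; sym = λ {β} {β'} → IsEquivalence.sym (~-isEquivalence f) {proj₁ β} {proj₁ β'}
    ; trans = λ {β} {β'} {β''} → IsEquivalence.trans (~-isEquivalence f) {proj₁ β} {proj₁ β'} {proj₁ β''}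
    }
  }

fOK+βℤ : ℕ → OK → Subset
fOK+βℤ f β x = Σ[ γ ∈ OK ] Σ[ m ∈ ℤ ] x ≡ ((+ f) · γ) +K (m · β)

ReducesTo : ℕ → Subset → OK → Set
ReducesTo f Λ β = Λ ≐ (λ x → Σ[ m ∈ ℤ ] (x ≡ᴷ m · β [mod f ]))

{-# OPTIONS --safe #-}
-- A primeval lattice Λ with coprime basis e₁, e₂ contains fO_K (because O_f ⊆ Ord Λ and 1 ∈ (e₁) + (e₂)),
-- and f divides det(e₁, e₂) (because det · ω stabilises Λ, so lies in Ord Λ = O_f). The norm form
-- N(e₁ + s e₂) = A + sT + s²C is then primitive modulo f with discriminant ≡ 0 mod f, so some value
-- N(w), w = e₁ + s e₂, is prime to f: w is a unit modulo f and Λ = ℤw + fO_K. Conversely, a unit β can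
-- be moved modulo f to β′ with coprime coordinates; completing β′ to a basis (β′, ρ) of O_K, the pair
-- β′, fρ is a coprime basis of fO_K + βℤ, whose order is O_f because β is invertible modulo f.
-- Finally ℤw + fO_K = ℤw′ + fO_K exactly when w′ ≡ u w for a unit u of ℤ/fℤ.
module Submission where

open import Defs
open import Data.Nat using (ℕ; suc; NonZero) renaming (_<_ to _<ℕ_)
import Data.Nat as ℕ
import Data.Nat.Properties as ℕ
import Data.Nat.GCD as ℕ
import Data.Nat.Divisibility as ℕ
open import Data.Nat.Induction using (<-rec)
open import Data.Integer using (ℤ; +_; _+_; _-_; _*_; -_; 0ℤ; 1ℤ; ∣_∣; _≟_; _<_)
import Data.Integer.Properties as ℤ
open import Data.Integer.Divisibility.Signed
open import Data.Integer.Tactic.RingSolver using (solve-∀)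
open import Data.Product using (Σ-syntax; _×_; _,_; proj₁; proj₂)
open import Data.Sum using ([_,_]′)
open import Function using (id)
open import Function.Bundles using (Inverse)
open import Relation.Nullary using (yes; no; contradiction)
open import Relation.Binary.PropositionalEquality
open ≡-Reasoning

BézoutCoprime : ℤ → ℤ → Set
BézoutCoprime x y = Σ[ u ∈ ℤ ] Σ[ v ∈ ℤ ] u * x + v * y ≡ 1ℤ

RelativelyPrime : ℤ → ℤ → Set
RelativelyPrime x y = ∀ c → c ∣ x → c ∣ y → c ∣ 1ℤ

Unimodular₃ : ℤ → ℤ → ℤ → Set
Unimodular₃ x y z = Σ[ a ∈ ℤ ] Σ[ b ∈ ℤ ] Σ[ c ∈ ℤ ] a * x + b * y + c * z ≡ 1ℤ

Unimodular₄ : ℤ → ℤ → ℤ → ℤ → Set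
Unimodular₄ x y z w = Σ[ a ∈ ℤ ] Σ[ b ∈ ℤ ] Σ[ c ∈ ℤ ] Σ[ d ∈ ℤ ] a * x + b * y + c * z + d * w ≡ 1ℤ

∣-resp-≡ : ∀ {c x y} → x ≡ y → c ∣ x → c ∣ y
∣-resp-≡ = subst (_ ∣_)

∣-linear : ∀ {c x y} a b → c ∣ x → c ∣ y → c ∣ a * x + b * y
∣-linear a b c∣x c∣y = ∣m∣n⇒∣m+n (∣n⇒∣m*n a c∣x) (∣n⇒∣m*n b c∣y)

∣0 : ∀ c → c ∣ 0ℤ
∣0 c = divides 0ℤ refl

ℕ-identity⇒combination : ∀ {d A B} → ℕ.Bézout.Identity d A B →
                          Σ[ u ∈ ℤ ] Σ[ v ∈ ℤ ] u * + A + v * + B ≡ + d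
ℕ-identity⇒combination {d} {A} {B} (ℕ.Bézout.+- x y eq) =
  + x , - + y , trans (swapSign (+ x) (+ A) (+ y) (+ B)) (difference {d} {x} {y} {A} {B} eq)
  where
  swapSign : ∀ a b c d → a * b + - c * d ≡ a * b - c * d
  swapSign = solve-∀
  difference : ∀ {d x y A B} → d ℕ.+ y ℕ.* B ≡ x ℕ.* A → + x * + A - + y * + B ≡ + d
  difference {d} {x} {y} {A} {B} eq = begin
    + x * + A - + y * + B      ≡⟨ cong₂ _-_ (sym (ℤ.pos-* x A)) (sym (ℤ.pos-* y B)) ⟩
    + (x ℕ.* A) - + (y ℕ.* B)  ≡⟨ cong (λ z → + z - + (y ℕ.* B)) (sym eq) ⟩
    + (d ℕ.+ y ℕ.* B) - + (y ℕ.* B) ≡⟨ cong (_- + (y ℕ.* B)) (ℤ.pos-+ d (y ℕ.* B)) ⟩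
    + d + + (y ℕ.* B) - + (y ℕ.* B) ≡⟨ cancel (+ d) (+ (y ℕ.* B)) ⟩
    + d                        ∎
    where
    cancel : ∀ a b → a + b - b ≡ a
    cancel = solve-∀
ℕ-identity⇒combination {A = A} {B} (ℕ.Bézout.-+ x y eq)
  with u , v , e ← ℕ-identity⇒combination (ℕ.Bézout.+- y x eq) = v , u , trans (ℤ.+-comm (v * + A) (u * + B)) e

bézout : ∀ a b → Σ[ d ∈ ℕ ] (+ d ∣ a) × (+ d ∣ b) × (Σ[ u ∈ ℤ ] Σ[ v ∈ ℤ ] u * a + v * b ≡ + d)
bézout a b with ℕ.Bézout.lemma ∣ a ∣ ∣ b ∣
... | ℕ.Bézout.result d g identity
  with u , v , e ← ℕ-identity⇒combination identity
     | divides k ∣a∣≡ka ← m∣∣m∣ {a}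
     | divides l ∣b∣≡lb ← m∣∣m∣ {b} =
  d , ∣ᵤ⇒∣ (ℕ.GCD.gcd∣m g) , ∣ᵤ⇒∣ (ℕ.GCD.gcd∣n g) , u * k , v * l , (begin
    u * k * a + v * l * b    ≡⟨ reassociate u k a v l b ⟩
    u * (k * a) + v * (l * b) ≡⟨ cong₂ (λ x y → u * x + v * y) (sym ∣a∣≡ka) (sym ∣b∣≡lb) ⟩
    u * + ∣ a ∣ + v * + ∣ b ∣ ≡⟨ e ⟩
    + d                      ∎)
  where
  reassociate : ∀ u k a v l b → u * k * a + v * l * b ≡ u * (k * a) + v * (l * b)
  reassociate = solve-∀

bézoutCoprime⇒relativelyPrime : ∀ {x y} → BézoutCoprime x y → RelativelyPrime x y
bézoutCoprime⇒relativelyPrime (u , v , e) c c∣x c∣y = ∣-resp-≡ e (∣-linear u v c∣x c∣y)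

relativelyPrime⇒bézoutCoprime : ∀ {x y} → RelativelyPrime x y → BézoutCoprime x y
relativelyPrime⇒bézoutCoprime {x} {y} rp
  with d , d∣x , d∣y , u , v , e ← bézout x y
  with divides k 1≡kd ← rp (+ d) d∣x d∣y = k * u , k * v , (begin
    k * u * x + k * v * y ≡⟨ factor k u v x y ⟩
    k * (u * x + v * y)   ≡⟨ cong (k *_) e ⟩
    k * + d               ≡⟨ sym 1≡kd ⟩
    1ℤ                    ∎)
  where
  factor : ∀ k u v x y → k * u * x + k * v * y ≡ k * (u * x + v * y)
  factor = solve-∀

bézoutCoprime-divisor : ∀ {d g q} → BézoutCoprime d g → d ∣ g * q → d ∣ q
bézoutCoprime-divisor {d} {g} {q} (u , v , e) d∣gq = ∣-resp-≡ (begin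
  q * u * d + v * (g * q) ≡⟨ factor q u v d g ⟩
  q * (u * d + v * g)     ≡⟨ cong (q *_) e ⟩
  q * 1ℤ                  ≡⟨ ℤ.*-identityʳ q ⟩
  q                       ∎) (∣-linear (q * u) v ∣-refl d∣gq)
  where
  factor : ∀ q u v d g → q * u * d + v * (g * q) ≡ q * (u * d + v * g)
  factor = solve-∀

bézoutCoprime-* : ∀ {c x y} → BézoutCoprime c x → BézoutCoprime c y → BézoutCoprime c (x * y)
bézoutCoprime-* {c} {x} {y} (u , v , e) (u′ , v′ , e′) =
  u * u′ * c + u * v′ * y + v * x * u′ , v * v′ , (begin
    (u * u′ * c + u * v′ * y + v * x * u′) * c + v * v′ * (x * y) ≡⟨ expand u v u′ v′ c x y ⟩
    (u * c + v * x) * (u′ * c + v′ * y)                           ≡⟨ cong₂ _*_ e e′ ⟩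
    1ℤ                                                            ∎)
  where
  expand : ∀ u v u′ v′ c x y →
           (u * u′ * c + u * v′ * y + v * x * u′) * c + v * v′ * (x * y) ≡ (u * c + v * x) * (u′ * c + v′ * y)
  expand = solve-∀

bézoutCoprime-abs : ∀ {x y} → BézoutCoprime x (+ ∣ y ∣) → BézoutCoprime x y
bézoutCoprime-abs {x} {y} (u , v , e) with divides k ∣y∣≡ky ← m∣∣m∣ {y} =
  u , v * k , trans (cong (λ z → u * x + z) (trans (ℤ.*-assoc v k y) (cong (v *_) (sym ∣y∣≡ky)))) e

-- s collects the prime factors of m that do not divide a.
CoprimePart : ℤ → ℕ → Set
CoprimePart a m = Σ[ s ∈ ℤ ] BézoutCoprime s a × (∀ d → d ∣ + m → RelativelyPrime d s → RelativelyPrime d a → d ∣ 1ℤ)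

coprime-part : ∀ a m → .{{NonZero m}} → CoprimePart a m
coprime-part a = <-rec (λ m → .{{NonZero m}} → CoprimePart a m) step
  where
  step : ∀ m → (∀ {k} → k ℕ.< m → .{{NonZero k}} → CoprimePart a k) → .{{NonZero m}} → CoprimePart a m
  step m rec with bézout a (+ m)
  ... | 0 , _ , 0∣m , _ = contradiction (ℤ.+-injective (0∣⇒≡0 0∣m)) (ℕ.≢-nonZero⁻¹ m)
  ... | 1 , _ , _ , u , v , e = + m , (v , u , trans (ℤ.+-comm (v * + m) (u * a)) e) , λ c c∣m c⊥m _ → c⊥m c ∣-refl c∣m
  ... | d@(suc (suc _)) , d∣a , d∣m , _ with ℕ.divides q m≡qd ← ∣⇒∣ᵤ d∣m =
    extend (rec {q} q<m {{q≢0}})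
    where
    extend : CoprimePart a q → CoprimePart a m
    extend (s , s⊥a , maximal) = s , s⊥a , λ c c∣m c⊥s c⊥a → maximal c (c∣q c c∣m c⊥a) c⊥s c⊥a
      where
      c∣q : ∀ c → c ∣ + m → RelativelyPrime c a → c ∣ + q
      c∣q c c∣m c⊥a = bézoutCoprime-divisor c⊥d (∣-resp-≡ m≡dq c∣m)
        where
        c⊥d : BézoutCoprime c (+ d)
        c⊥d = relativelyPrime⇒bézoutCoprime (λ e e∣c e∣d → c⊥a e e∣c (∣-trans e∣d d∣a))
        m≡dq : + m ≡ + d * + q
        m≡dq = trans (cong +_ (trans m≡qd (ℕ.*-comm q d))) (ℤ.pos-* d q)
    q≢0 : NonZero q
    q≢0 = ℕ.≢-nonZero (λ { refl → ℕ.≢-nonZero⁻¹ m m≡qd })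
    q<m : q ℕ.< m
    q<m = subst (q ℕ.<_) (sym m≡qd) (ℕ.m<m*n q d {{q≢0}} (ℕ.s≤s (ℕ.s≤s ℕ.z≤n)))

-- c divides the square of E = αA + βB + zM, and squaring 1 = E + γC exhibits c and C as coprime.
unimodular⇒coprime : ∀ {c} A B C M → Unimodular₄ A B C M → c ∣ A → c ∣ B * B → c ∣ M → BézoutCoprime c C
unimodular⇒coprime {c} A B C M (α , β , γ , z , unimodular) c∣A c∣B² c∣M = fromSquare c∣E²
  where
  E = α * A + β * B + z * M
  c∣E² : c ∣ E * E
  c∣E² = ∣-resp-≡ (square α A β B z M)
    (∣m∣n⇒∣m+n (∣m⇒∣m*n (α * A + z * M + (β * B + β * B)) (∣-linear α z c∣A c∣M)) (∣n⇒∣m*n (β * β) c∣B²))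
    where
    square : ∀ α A β B z M → (α * A + z * M) * (α * A + z * M + (β * B + β * B)) + β * β * (B * B)
                           ≡ (α * A + β * B + z * M) * (α * A + β * B + z * M)
    square = solve-∀
  E+γC≡1 : E + γ * C ≡ 1ℤ
  E+γC≡1 = trans (reorder α A β B γ C z M) unimodular
    where
    reorder : ∀ α A β B γ C z M → α * A + β * B + z * M + γ * C ≡ α * A + β * B + γ * C + z * M
    reorder = solve-∀
  fromSquare : c ∣ E * E → BézoutCoprime c C
  fromSquare (divides e E²≡ec) = e , γ * (E + E + γ * C) , (begin
    e * c + γ * (E + E + γ * C) * C              ≡⟨ complete e c γ E C ⟩
    e * c - E * E + (E + γ * C) * (E + γ * C)    ≡⟨ cong (λ w → e * c - E * E + w * w) E+γC≡1 ⟩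
    e * c - E * E + 1ℤ * 1ℤ                      ≡⟨ cong (λ w → w - E * E + 1ℤ * 1ℤ) (sym E²≡ec) ⟩
    E * E - E * E + 1ℤ * 1ℤ                      ≡⟨ vanish (E * E) ⟩
    1ℤ                                           ∎)
    where
    complete : ∀ e c γ E C → e * c + γ * (E + E + γ * C) * C ≡ e * c - E * E + (E + γ * C) * (E + γ * C)
    complete = solve-∀
    vanish : ∀ x → x - x + 1ℤ * 1ℤ ≡ 1ℤ
    vanish = solve-∀

-- For s the part of m coprime to A, a common divisor c of Q(s) = A + sT + s²C and m is a unit:
-- c is coprime to s since A ≡ Q(s) mod s; and if c | A then c | B², so c is coprime to C,
-- while c | Q(s) - A - s(T - 2B) = 2sB + s²C gives c | (2sB + s²C)(s²C - 2sB) + 4s²B² = s⁴C².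
coprime-value : ∀ A B C T m → .{{NonZero m}} → + m ∣ A * C - B * B → + m ∣ T - (B + B) →
               Unimodular₄ A B C (+ m) → Σ[ s ∈ ℤ ] BézoutCoprime (A + s * T + s * s * C) (+ m)
coprime-value A B C T m m∣AC-B² m∣T-2B unimodular
  with s , (u , v , us+vA≡1) , maximal ← coprime-part A m =
  s , relativelyPrime⇒bézoutCoprime (λ d d∣Q d∣m → maximal d d∣m (d⊥s d d∣Q) (d⊥A d d∣Q d∣m))
  where
  Q = A + s * T + s * s * C
  d⊥s : ∀ d → d ∣ Q → RelativelyPrime d s
  d⊥s d d∣Q c c∣d c∣s = ∣-resp-≡ us+vA≡1 (∣-linear u v c∣s
    (∣-resp-≡ (remainder A s T C) (∣m∣n⇒∣m-n (∣-trans c∣d d∣Q) (∣m⇒∣m*n (T + s * C) c∣s))))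
    where
    remainder : ∀ A s T C → A + s * T + s * s * C - s * (T + s * C) ≡ A
    remainder = solve-∀
  d⊥A : ∀ d → d ∣ Q → d ∣ + m → RelativelyPrime d A
  d⊥A d d∣Q d∣m c c∣d c∣A = bézoutCoprime⇒relativelyPrime c⊥s⁴C² c ∣-refl c∣s⁴C²
    where
    c∣m = ∣-trans c∣d d∣m
    c∣B² : c ∣ B * B
    c∣B² = ∣-resp-≡ (difference A B C) (∣m∣n⇒∣m-n (∣m⇒∣m*n C c∣A) (∣-trans c∣m m∣AC-B²))
      where
      difference : ∀ A B C → A * C - (A * C - B * B) ≡ B * B
      difference = solve-∀
    c⊥C : BézoutCoprime c C
    c⊥C = unimodular⇒coprime A B C (+ m) unimodular c∣A c∣B² c∣m
    c⊥s : BézoutCoprime c s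
    c⊥s = fromQuotient c∣A
      where
      fromQuotient : c ∣ A → BézoutCoprime c s
      fromQuotient (divides a A≡ac) = v * a , u , (begin
        v * a * c + u * s   ≡⟨ rearrange v a c u s ⟩
        u * s + v * (a * c) ≡⟨ cong (λ w → u * s + v * w) (sym A≡ac) ⟩
        u * s + v * A       ≡⟨ us+vA≡1 ⟩
        1ℤ                  ∎)
        where
        rearrange : ∀ v a c u s → v * a * c + u * s ≡ u * s + v * (a * c)
        rearrange = solve-∀
    c⊥s⁴C² : BézoutCoprime c (s * s * (s * s) * (C * C))
    c⊥s⁴C² = bézoutCoprime-* (bézoutCoprime-* (bézoutCoprime-* c⊥s c⊥s) (bézoutCoprime-* c⊥s c⊥s)) (bézoutCoprime-* c⊥C c⊥C)
    c∣2sB+s²C : c ∣ s * (B + B) + s * s * C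
    c∣2sB+s²C = ∣-resp-≡ (linearPart A s T C B)
      (∣m∣n⇒∣m-n (∣m∣n⇒∣m-n (∣-trans c∣d d∣Q) c∣A) (∣n⇒∣m*n s (∣-trans c∣m m∣T-2B)))
      where
      linearPart : ∀ A s T C B → A + s * T + s * s * C - A - s * (T - (B + B)) ≡ s * (B + B) + s * s * C
      linearPart = solve-∀
    c∣s⁴C² : c ∣ s * s * (s * s) * (C * C)
    c∣s⁴C² = ∣-resp-≡ (differenceOfSquares s B C)
      (∣m∣n⇒∣m+n (∣m⇒∣m*n (s * s * C - s * (B + B)) c∣2sB+s²C) (∣n⇒∣m*n (s * s * + 4) c∣B²))
      where
      differenceOfSquares : ∀ s B C → (s * (B + B) + s * s * C) * (s * s * C - s * (B + B)) + s * s * + 4 * (B * B)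
                                    ≡ s * s * (s * s) * (C * C)
      differenceOfSquares = solve-∀

-- Apply coprime-value to the square (p + sF)² = p² + s(2pF) + s²F², a form of discriminant 0.
coprime-shift : ∀ p q F → q ≢ 0ℤ → Unimodular₃ p q F → Σ[ s ∈ ℤ ] BézoutCoprime (p + s * F) q
coprime-shift p q F q≢0 (a , b , c , ap+bq+cF≡1)
  with divides k q≡k∣q∣ ← ∣m∣∣m {q}
  = fromSquare (coprime-value (p * p) (p * F) (F * F) (p * F + p * F) ∣ q ∣ {{∣q∣≢0}}
                  (∣-resp-≡ (sym (zeroDiscriminant p F)) (∣0 _)) (∣-resp-≡ (sym (ℤ.+-inverseʳ (p * F + p * F))) (∣0 _))
                  unimodular)
  where
  ∣q∣≢0 : NonZero ∣ q ∣
  ∣q∣≢0 = ℕ.≢-nonZero (λ ∣q∣≡0 → q≢0 (ℤ.∣i∣≡0⇒i≡0 ∣q∣≡0))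
  fromSquare : Σ[ s ∈ ℤ ] BézoutCoprime (p * p + s * (p * F + p * F) + s * s * (F * F)) (+ ∣ q ∣) →
               Σ[ s ∈ ℤ ] BézoutCoprime (p + s * F) q
  fromSquare (s , u , v , e) = s , bézoutCoprime-abs (u * (p + s * F) , v , (begin
    u * (p + s * F) * (p + s * F) + v * + ∣ q ∣ ≡⟨ cong (λ w → w + v * + ∣ q ∣) (ℤ.*-assoc u (p + s * F) (p + s * F)) ⟩
    u * ((p + s * F) * (p + s * F)) + v * + ∣ q ∣ ≡⟨ cong (λ w → u * w + v * + ∣ q ∣) (sym (square p s F)) ⟩
    u * (p * p + s * (p * F + p * F) + s * s * (F * F)) + v * + ∣ q ∣ ≡⟨ e ⟩
    1ℤ ∎))
    where
    square : ∀ p s F → p * p + s * (p * F + p * F) + s * s * (F * F) ≡ (p + s * F) * (p + s * F)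
    square = solve-∀
  zeroDiscriminant : ∀ p F → p * p * (F * F) - p * F * (p * F) ≡ 0ℤ
  zeroDiscriminant = solve-∀
  X = a * p + b * q + c * F
  unimodular : Unimodular₄ (p * p) (p * F) (F * F) (+ ∣ q ∣)
  unimodular = a * a , a * c + a * c , c * c , (b + b - b * b * q) * k , (begin
    a * a * (p * p) + (a * c + a * c) * (p * F) + c * c * (F * F) + (b + b - b * b * q) * k * + ∣ q ∣
      ≡⟨ cong (λ w → a * a * (p * p) + (a * c + a * c) * (p * F) + c * c * (F * F) + w)
              (trans (ℤ.*-assoc (b + b - b * b * q) k (+ ∣ q ∣)) (cong ((b + b - b * b * q) *_) (sym q≡k∣q∣))) ⟩
    a * a * (p * p) + (a * c + a * c) * (p * F) + c * c * (F * F) + (b + b - b * b * q) * q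
      ≡⟨ expand a b c p q F ⟩
    X * X - (b * q + b * q) * (X - 1ℤ) ≡⟨ cong (λ w → w * w - (b * q + b * q) * (w - 1ℤ)) ap+bq+cF≡1 ⟩
    1ℤ * 1ℤ - (b * q + b * q) * (1ℤ - 1ℤ) ≡⟨ one (b * q + b * q) ⟩
    1ℤ ∎)
    where
    expand : ∀ a b c p q F → a * a * (p * p) + (a * c + a * c) * (p * F) + c * c * (F * F) + (b + b - b * b * q) * q
           ≡ (a * p + b * q + c * F) * (a * p + b * q + c * F) - (b * q + b * q) * ((a * p + b * q + c * F) - 1ℤ)
    expand = solve-∀
    one : ∀ y → 1ℤ * 1ℤ - y * (1ℤ - 1ℤ) ≡ 1ℤ
    one = solve-∀

coprime-translate : ∀ p q F → Unimodular₃ p q F → Σ[ μ₀ ∈ ℤ ] Σ[ μ₁ ∈ ℤ ] BézoutCoprime (p + μ₀ * F) (q + μ₁ * F)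
coprime-translate p q F (a , b , c , e) with q ≟ 0ℤ
... | yes refl = 0ℤ , 1ℤ , a , c , trans (drop a p F b c) e
  where
  drop : ∀ a p F b c → a * (p + 0ℤ * F) + c * (0ℤ + 1ℤ * F) ≡ a * p + b * 0ℤ + c * F
  drop = solve-∀
... | no q≢0 = fromShift (coprime-shift p q F q≢0 (a , b , c , e))
  where
  addZero : ∀ q F → q ≡ q + 0ℤ * F
  addZero = solve-∀
  fromShift : Σ[ s ∈ ℤ ] BézoutCoprime (p + s * F) q → Σ[ μ₀ ∈ ℤ ] Σ[ μ₁ ∈ ℤ ] BézoutCoprime (p + μ₀ * F) (q + μ₁ * F)
  fromShift (s , p+sF⊥q) = s , 0ℤ , subst (BézoutCoprime (p + s * F)) (addZero q F) p+sF⊥q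

cancel-invertible : ∀ {F} x N c y {u v} → u * N + v * F ≡ 1ℤ → F ∣ x * N - c * y → F ∣ x - u * c * y
cancel-invertible {F} x N c y {u} {v} uN+vF≡1 F∣xN-cy =
  ∣-resp-≡ (begin
    x * v * F + u * (x * N - c * y) ≡⟨ regroup x N c y u v F ⟩
    x * (u * N + v * F) - u * c * y ≡⟨ cong (λ z → x * z - u * c * y) uN+vF≡1 ⟩
    x * 1ℤ - u * c * y              ≡⟨ cong (_- u * c * y) (ℤ.*-identityʳ x) ⟩
    x - u * c * y                   ∎)
  (∣-linear (x * v) u ∣-refl F∣xN-cy)
  where
  regroup : ∀ x N c y u v F → x * v * F + u * (x * N - c * y) ≡ x * (u * N + v * F) - u * c * y
  regroup = solve-∀

≡-scaled-refl : ∀ {F} x → F ∣ x - 1ℤ * x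
≡-scaled-refl {F} x = ∣-resp-≡ (vanish x) (∣0 F)
  where
  vanish : ∀ x → 0ℤ ≡ x - 1ℤ * x
  vanish = solve-∀

≡-scaled-trans : ∀ {F} x y z a b → F ∣ x - a * y → F ∣ y - b * z → F ∣ x - (a * b) * z
≡-scaled-trans x y z a b F∣x-ay F∣y-bz = ∣-resp-≡ (sym (chain x y z a b)) (∣m∣n⇒∣m+n F∣x-ay (∣n⇒∣m*n a F∣y-bz))
  where
  chain : ∀ x y z a b → x - (a * b) * z ≡ (x - a * y) + a * (y - b * z)
  chain = solve-∀

≡-scaled-sym : ∀ {F} x y u v → F ∣ y - u * x → F ∣ u * v - 1ℤ → F ∣ x - v * y
≡-scaled-sym x y u v F∣y-ux F∣uv-1 =
  ∣-resp-≡ (sym (invert x y u v)) (∣m∣n⇒∣m-n (∣m⇒∣-m (∣n⇒∣m*n v F∣y-ux)) (∣m⇒∣m*n x F∣uv-1))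
  where
  invert : ∀ x y u v → x - v * y ≡ - (v * (y - u * x)) - (u * v - 1ℤ) * x
  invert = solve-∀

OK-≡ : ∀ {x y : OK} → re x ≡ re y → im x ≡ im y → x ≡ y
OK-≡ = cong₂ _+_ω

lincomb : OK → OK → ℤ → ℤ → OK
lincomb e₁ e₂ a b = (a · e₁) +K (b · e₂)

det : OK → OK → ℤ
det e₁ e₂ = re e₁ * im e₂ - im e₁ * re e₂

Multiples : ℕ → OK → Subset
Multiples f β x = Σ[ m ∈ ℤ ] (x ≡ᴷ m · β [mod f ])

module _ {Λ : Subset} {e₁ e₂ : OK} (basis : IsBasis Λ e₁ e₂) where

  basis-coords : ∀ {x} → Λ x → Σ[ a ∈ ℤ ] Σ[ b ∈ ℤ ] x ≡ lincomb e₁ e₂ a b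
  basis-coords {x} = proj₁ (proj₂ basis x)

  basis-lincomb : ∀ a b → Λ (lincomb e₁ e₂ a b)
  basis-lincomb a b = proj₂ (proj₂ basis (lincomb e₁ e₂ a b)) (a , b , refl)

  lattice-+ : ∀ {x y} → Λ x → Λ y → Λ (x +K y)
  lattice-+ x∈Λ y∈Λ with a , b , refl ← basis-coords x∈Λ | c , d , refl ← basis-coords y∈Λ =
    subst Λ (sym (OK-≡ (add a b c d (re e₁) (re e₂)) (add a b c d (im e₁) (im e₂)))) (basis-lincomb (a + c) (b + d))
    where
    add : ∀ a b c d x y → a * x + b * y + (c * x + d * y) ≡ (a + c) * x + (b + d) * y
    add = solve-∀

  lattice-· : ∀ m {x} → Λ x → Λ (m · x)
  lattice-· m x∈Λ with a , b , refl ← basis-coords x∈Λ =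
    subst Λ (sym (OK-≡ (scale m a b (re e₁) (re e₂)) (scale m a b (im e₁) (im e₂)))) (basis-lincomb (m * a) (m * b))
    where
    scale : ∀ m a b x y → m * (a * x + b * y) ≡ m * a * x + m * b * y
    scale = solve-∀

  basis-∈₁ : Λ e₁
  basis-∈₁ = subst Λ (sym (OK-≡ (first (re e₁) (re e₂)) (first (im e₁) (im e₂)))) (basis-lincomb 1ℤ 0ℤ)
    where
    first : ∀ x y → x ≡ 1ℤ * x + 0ℤ * y
    first = solve-∀

  basis-∈₂ : Λ e₂
  basis-∈₂ = subst Λ (sym (OK-≡ (second (re e₁) (re e₂)) (second (im e₁) (im e₂)))) (basis-lincomb 0ℤ 1ℤ)
    where
    second : ∀ x y → y ≡ 0ℤ * x + 1ℤ * y
    second = solve-∀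

  det·-∈ : ∀ y → Λ (det e₁ e₂ · y)
  det·-∈ y = subst Λ (sym (OK-≡ (cramer a₀ a₁ b₀ b₁ (re y) (im y)) (cramer′ a₀ a₁ b₀ b₁ (re y) (im y))))
                     (basis-lincomb (b₁ * re y - b₀ * im y) (a₀ * im y - a₁ * re y))
    where
    a₀ = re e₁
    a₁ = im e₁
    b₀ = re e₂
    b₁ = im e₂
    cramer : ∀ a₀ a₁ b₀ b₁ y₀ y₁ → (a₀ * b₁ - a₁ * b₀) * y₀ ≡ (b₁ * y₀ - b₀ * y₁) * a₀ + (a₀ * y₁ - a₁ * y₀) * b₀
    cramer = solve-∀
    cramer′ : ∀ a₀ a₁ b₀ b₁ y₀ y₁ → (a₀ * b₁ - a₁ * b₀) * y₁ ≡ (b₁ * y₀ - b₀ * y₁) * a₁ + (a₀ * y₁ - a₁ * y₀) * b₁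
    cramer′ = solve-∀

≐-sym : ∀ {Λ Λ′} → Λ ≐ Λ′ → Λ′ ≐ Λ
≐-sym Λ≐Λ′ x = proj₂ (Λ≐Λ′ x) , proj₁ (Λ≐Λ′ x)

≐-trans : ∀ {Λ Λ′ Λ″} → Λ ≐ Λ′ → Λ′ ≐ Λ″ → Λ ≐ Λ″
≐-trans Λ≐Λ′ Λ′≐Λ″ x = (λ p → proj₁ (Λ′≐Λ″ x) (proj₁ (Λ≐Λ′ x) p)) , (λ p → proj₂ (Λ≐Λ′ x) (proj₂ (Λ′≐Λ″ x) p))

fOK+βℤ≐Multiples : ∀ f β → fOK+βℤ f β ≐ Multiples f β
fOK+βℤ≐Multiples f β x =
    (λ { (γ , m , x≡) → m , divides (re γ) (shift (re x) (re γ) m (re β) (cong re x≡))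
                          , divides (im γ) (shift (im x) (im γ) m (im β) (cong im x≡)) })
  , (λ { (m , divides k₀ re≡ , divides k₁ im≡) →
           (k₀ + k₁ ω) , m , OK-≡ (unshift (re x) k₀ m (re β) re≡) (unshift (im x) k₁ m (im β) im≡) })
  where
  shift : ∀ x g m b → x ≡ + f * g + m * b → x - m * b ≡ g * + f
  shift x g m b refl = identity (+ f) g m b
    where
    identity : ∀ F g m b → F * g + m * b - m * b ≡ g * F
    identity = solve-∀
  unshift : ∀ x k m b → x - m * b ≡ k * + f → x ≡ + f * k + m * b
  unshift x k m b x-mb≡kf = trans (sym (identity x (m * b))) (trans (cong (_+ m * b) x-mb≡kf) (cong (_+ m * b) (ℤ.*-comm k (+ f))))
    where
    identity : ∀ x y → x - y + y ≡ x
    identity = solve-∀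

~⇒Multiples-≐ : ∀ {f w w′} → w ~[ f ] w′ → Multiples f w ≐ Multiples f w′
~⇒Multiples-≐ {w = w} {w′} (u , (v , f∣uv-1) , re≡ , im≡) x =
    (λ { (m , re-x , im-x) → m * v , ≡-scaled-trans (re x) (re w) (re w′) m v re-x (≡-scaled-sym (re w) (re w′) u v re≡ f∣uv-1)
                                   , ≡-scaled-trans (im x) (im w) (im w′) m v im-x (≡-scaled-sym (im w) (im w′) u v im≡ f∣uv-1) })
  , (λ { (m , re-x , im-x) → m * u , ≡-scaled-trans (re x) (re w′) (re w) m u re-x re≡
                                   , ≡-scaled-trans (im x) (im w′) (im w) m u im-x im≡ })

module _ (t n : ℤ) where

  infixl 7 _⋆_

  _⋆_ : OK → OK → OK
  _⋆_ = mulK t n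

  conj : OK → OK
  conj x = (re x + t * im x) + (- im x) ω

  nrm : OK → ℤ
  nrm x = re x * re x + t * re x * im x + n * im x * im x

  ⋆-identityʳ : ∀ x → x ⋆ oneK ≡ x
  ⋆-identityʳ x = OK-≡ (reIdentity (re x) (im x) n) (imIdentity (re x) (im x) t)
    where
    reIdentity : ∀ a b n → a * 1ℤ - b * 0ℤ * n ≡ a
    reIdentity = solve-∀
    imIdentity : ∀ a b t → a * 0ℤ + b * 1ℤ + b * 0ℤ * t ≡ b
    imIdentity = solve-∀

  ⋆-distribˡ : ∀ x y z → x ⋆ (y +K z) ≡ x ⋆ y +K x ⋆ z
  ⋆-distribˡ x y z = OK-≡ (reDistrib (re x) (im x) (re y) (im y) (re z) (im z) t n)
                          (imDistrib (re x) (im x) (re y) (im y) (re z) (im z) t n)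
    where
    reDistrib : ∀ a b c d e g t n → a * (c + e) - b * (d + g) * n ≡ (a * c - b * d * n) + (a * e - b * g * n)
    reDistrib = solve-∀
    imDistrib : ∀ a b c d e g t n → a * (d + g) + b * (c + e) + b * (d + g) * t
                                  ≡ (a * d + b * c + b * d * t) + (a * g + b * e + b * g * t)
    imDistrib = solve-∀

  ⋆-assoc : ∀ x y z → (x ⋆ y) ⋆ z ≡ x ⋆ (y ⋆ z)
  ⋆-assoc x y z = OK-≡ (reAssoc (re x) (im x) (re y) (im y) (re z) (im z) t n)
                       (imAssoc (re x) (im x) (re y) (im y) (re z) (im z) t n)
    where
    reAssoc : ∀ a b c d e g t n → (a * c - b * d * n) * e - (a * d + b * c + b * d * t) * g * n
                                ≡ a * (c * e - d * g * n) - b * (c * g + d * e + d * g * t) * n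
    reAssoc = solve-∀
    imAssoc : ∀ a b c d e g t n →
              (a * c - b * d * n) * g + (a * d + b * c + b * d * t) * e + (a * d + b * c + b * d * t) * g * t
              ≡ a * (c * g + d * e + d * g * t) + b * (c * e - d * g * n) + b * (c * g + d * e + d * g * t) * t
    imAssoc = solve-∀

  ∣-⋆ : ∀ {k} w v → k ∣ re w → k ∣ im w → (k ∣ re (w ⋆ v)) × (k ∣ im (w ⋆ v))
  ∣-⋆ w v k∣re k∣im =
      ∣m∣n⇒∣m-n (∣m⇒∣m*n (re v) k∣re) (∣m⇒∣m*n n (∣m⇒∣m*n (im v) k∣im))
    , ∣m∣n⇒∣m+n (∣m∣n⇒∣m+n (∣m⇒∣m*n (im v) k∣re) (∣m⇒∣m*n (re v) k∣im)) (∣m⇒∣m*n t (∣m⇒∣m*n (im v) k∣im))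

  trace : OK → ℤ
  trace z = re z + re z + t * im z

  ⋆-·conj : ∀ u w → w ⋆ (u · conj w) ≡ (u * nrm w) + 0ℤ ω
  ⋆-·conj u w = OK-≡ (reNorm u (re w) (im w) t n) (imNorm u (re w) (im w) t n)
    where
    reNorm : ∀ u w₀ w₁ t n → w₀ * (u * (w₀ + t * w₁)) - w₁ * (u * (- w₁)) * n ≡ u * (w₀ * w₀ + t * w₀ * w₁ + n * w₁ * w₁)
    reNorm = solve-∀
    imNorm : ∀ u w₀ w₁ t n → w₀ * (u * (- w₁)) + w₁ * (u * (w₀ + t * w₁)) + w₁ * (u * (- w₁)) * t ≡ 0ℤ
    imNorm = solve-∀

  -- x N(w) = (x w̄) w, so x N(w) ≡ re (x w̄) · w modulo im (x w̄).
  ⋆conj-⋆ : ∀ x w → (re x * nrm w - re (x ⋆ conj w) * re w ≡ im (x ⋆ conj w) * (- (im w * n)))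
                  × (im x * nrm w - re (x ⋆ conj w) * im w ≡ im (x ⋆ conj w) * (re w + im w * t))
  ⋆conj-⋆ x w = reSplit (re x) (im x) (re w) (im w) t n , imSplit (re x) (im x) (re w) (im w) t n
    where
    reSplit : ∀ x₀ x₁ w₀ w₁ t n →
              x₀ * (w₀ * w₀ + t * w₀ * w₁ + n * w₁ * w₁) - (x₀ * (w₀ + t * w₁) - x₁ * (- w₁) * n) * w₀
              ≡ (x₀ * (- w₁) + x₁ * (w₀ + t * w₁) + x₁ * (- w₁) * t) * (- (w₁ * n))
    reSplit = solve-∀
    imSplit : ∀ x₀ x₁ w₀ w₁ t n →
              x₁ * (w₀ * w₀ + t * w₀ * w₁ + n * w₁ * w₁) - (x₀ * (w₀ + t * w₁) - x₁ * (- w₁) * n) * w₁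
              ≡ (x₀ * (- w₁) + x₁ * (w₀ + t * w₁) + x₁ * (- w₁) * t) * (w₀ + w₁ * t)
    imSplit = solve-∀

  -- The binary quadratic form N(x e₁ + y e₂) = A x² + T x y + C y²; with B = re (e₁ ē₂) one has
  -- T ≡ 2B and AC ≡ B² modulo im (e₁ ē₂) = − det(e₁, e₂).
  module NormForm (e₁ e₂ : OK) where

    A C B T : ℤ
    A = nrm e₁
    C = nrm e₂
    B = re (e₁ ⋆ conj e₂)
    T = trace (e₁ ⋆ conj e₂)

    a₀ a₁ b₀ b₁ : ℤ
    a₀ = re e₁
    a₁ = im e₁
    b₀ = re e₂
    b₁ = im e₂

    im-⋆conj : im (e₁ ⋆ conj e₂) ≡ - det e₁ e₂
    im-⋆conj = identity a₀ a₁ b₀ b₁ t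
      where
      identity : ∀ a₀ a₁ b₀ b₁ t → a₀ * (- b₁) + a₁ * (b₀ + t * b₁) + a₁ * (- b₁) * t ≡ - (a₀ * b₁ - a₁ * b₀)
      identity = solve-∀

    AC-B² : A * C - B * B ≡ im (e₁ ⋆ conj e₂) * (t * B + n * im (e₁ ⋆ conj e₂))
    AC-B² = identity a₀ a₁ b₀ b₁ t n
      where
      identity : ∀ a₀ a₁ b₀ b₁ t n →
        (a₀ * a₀ + t * a₀ * a₁ + n * a₁ * a₁) * (b₀ * b₀ + t * b₀ * b₁ + n * b₁ * b₁)
          - (a₀ * (b₀ + t * b₁) - a₁ * (- b₁) * n) * (a₀ * (b₀ + t * b₁) - a₁ * (- b₁) * n)
        ≡ (a₀ * (- b₁) + a₁ * (b₀ + t * b₁) + a₁ * (- b₁) * t)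
          * (t * (a₀ * (b₀ + t * b₁) - a₁ * (- b₁) * n) + n * (a₀ * (- b₁) + a₁ * (b₀ + t * b₁) + a₁ * (- b₁) * t))
      identity = solve-∀

    T-2B : T - (B + B) ≡ t * im (e₁ ⋆ conj e₂)
    T-2B = identity B t (im (e₁ ⋆ conj e₂))
      where
      identity : ∀ B t k → B + B + t * k - (B + B) ≡ t * k
      identity = solve-∀

    nrm-lincomb : ∀ s → nrm (lincomb e₁ e₂ 1ℤ s) ≡ A + s * T + s * s * C
    nrm-lincomb s = identity s a₀ a₁ b₀ b₁ t n
      where
      identity : ∀ s a₀ a₁ b₀ b₁ t n →
        (1ℤ * a₀ + s * b₀) * (1ℤ * a₀ + s * b₀) + t * (1ℤ * a₀ + s * b₀) * (1ℤ * a₁ + s * b₁)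
          + n * (1ℤ * a₁ + s * b₁) * (1ℤ * a₁ + s * b₁)
        ≡ (a₀ * a₀ + t * a₀ * a₁ + n * a₁ * a₁)
          + s * ((a₀ * (b₀ + t * b₁) - a₁ * (- b₁) * n) + (a₀ * (b₀ + t * b₁) - a₁ * (- b₁) * n)
                 + t * (a₀ * (- b₁) + a₁ * (b₀ + t * b₁) + a₁ * (- b₁) * t))
          + s * s * (b₀ * b₀ + t * b₀ * b₁ + n * b₁ * b₁)
      identity = solve-∀

    im-lincomb⋆conj : ∀ p q s → im (lincomb e₁ e₂ p q ⋆ conj (lincomb e₁ e₂ 1ℤ s)) ≡ (q - p * s) * det e₁ e₂
    im-lincomb⋆conj p q s = identity p q s a₀ a₁ b₀ b₁ t
      where
      identity : ∀ p q s a₀ a₁ b₀ b₁ t →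
        (p * a₀ + q * b₀) * (- (1ℤ * a₁ + s * b₁)) + (p * a₁ + q * b₁) * ((1ℤ * a₀ + s * b₀) + t * (1ℤ * a₁ + s * b₁))
          + (p * a₁ + q * b₁) * (- (1ℤ * a₁ + s * b₁)) * t
        ≡ (q - p * s) * (a₀ * b₁ - a₁ * b₀)
      identity = solve-∀

    nrm-⋆-combination : ∀ X Y → let Q = X ⋆ conj Y in
      nrm (X ⋆ e₁ +K Y ⋆ e₂)
      ≡ nrm X * A + trace Q * B + nrm Y * C + im (e₁ ⋆ conj e₂) * (t * re Q - (n + n) * im Q + t * t * im Q)
    nrm-⋆-combination X Y = identity (re X) (im X) (re Y) (im Y) a₀ a₁ b₀ b₁ t n
      where
      identity : ∀ X₀ X₁ Y₀ Y₁ a₀ a₁ b₀ b₁ t n →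
        ((X₀ * a₀ - X₁ * a₁ * n) + (Y₀ * b₀ - Y₁ * b₁ * n)) * ((X₀ * a₀ - X₁ * a₁ * n) + (Y₀ * b₀ - Y₁ * b₁ * n))
          + t * ((X₀ * a₀ - X₁ * a₁ * n) + (Y₀ * b₀ - Y₁ * b₁ * n)) * ((X₀ * a₁ + X₁ * a₀ + X₁ * a₁ * t) + (Y₀ * b₁ + Y₁ * b₀ + Y₁ * b₁ * t))
          + n * ((X₀ * a₁ + X₁ * a₀ + X₁ * a₁ * t) + (Y₀ * b₁ + Y₁ * b₀ + Y₁ * b₁ * t)) * ((X₀ * a₁ + X₁ * a₀ + X₁ * a₁ * t) + (Y₀ * b₁ + Y₁ * b₀ + Y₁ * b₁ * t))
        ≡ (X₀ * X₀ + t * X₀ * X₁ + n * X₁ * X₁) * (a₀ * a₀ + t * a₀ * a₁ + n * a₁ * a₁)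
          + ((X₀ * (Y₀ + t * Y₁) - X₁ * (- Y₁) * n) + (X₀ * (Y₀ + t * Y₁) - X₁ * (- Y₁) * n)
             + t * (X₀ * (- Y₁) + X₁ * (Y₀ + t * Y₁) + X₁ * (- Y₁) * t)) * (a₀ * (b₀ + t * b₁) - a₁ * (- b₁) * n)
          + (Y₀ * Y₀ + t * Y₀ * Y₁ + n * Y₁ * Y₁) * (b₀ * b₀ + t * b₀ * b₁ + n * b₁ * b₁)
          + (a₀ * (- b₁) + a₁ * (b₀ + t * b₁) + a₁ * (- b₁) * t)
            * (t * (X₀ * (Y₀ + t * Y₁) - X₁ * (- Y₁) * n) - (n + n) * (X₀ * (- Y₁) + X₁ * (Y₀ + t * Y₁) + X₁ * (- Y₁) * t)
               + t * t * (X₀ * (- Y₁) + X₁ * (Y₀ + t * Y₁) + X₁ * (- Y₁) * t))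
      identity = solve-∀

  module _ (f : ℕ) where

    ·-∈fOK : ∀ z → (+ f ∣ re (+ f · z)) × (+ f ∣ im (+ f · z))
    ·-∈fOK z = ∣m⇒∣m*n (re z) ∣-refl , ∣m⇒∣m*n (im z) ∣-refl

    fOK⊆Λ : ∀ {Λ e₁ e₂} → IsBasis Λ e₁ e₂ → Coprime t n e₁ e₂ →
            (∀ α → InOrder f α → ∀ x → Λ x → Λ (α ⋆ x)) → ∀ z → Λ (+ f · z)
    fOK⊆Λ {Λ} {e₁} {e₂} basis (X , Y , Xe₁+Ye₂≡1) O_f⊆Ord z =
      subst Λ (sym decomposition) (lattice-+ basis (inΛ X e₁ (basis-∈₁ basis)) (inΛ Y e₂ (basis-∈₂ basis)))
      where
      w = + f · z
      inΛ : ∀ V e → Λ e → Λ ((w ⋆ V) ⋆ e)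
      inΛ V = O_f⊆Ord (w ⋆ V) (proj₂ (∣-⋆ w V (proj₁ (·-∈fOK z)) (proj₂ (·-∈fOK z))))
      decomposition : w ≡ (w ⋆ X) ⋆ e₁ +K (w ⋆ Y) ⋆ e₂
      decomposition = begin
        w                              ≡⟨ sym (⋆-identityʳ w) ⟩
        w ⋆ oneK                       ≡⟨ cong (w ⋆_) (sym Xe₁+Ye₂≡1) ⟩
        w ⋆ (X ⋆ e₁ +K Y ⋆ e₂)         ≡⟨ ⋆-distribˡ w (X ⋆ e₁) (Y ⋆ e₂) ⟩
        w ⋆ (X ⋆ e₁) +K w ⋆ (Y ⋆ e₂)   ≡⟨ sym (cong₂ _+K_ (⋆-assoc w X e₁) (⋆-assoc w Y e₂)) ⟩
        (w ⋆ X) ⋆ e₁ +K (w ⋆ Y) ⋆ e₂   ∎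

    f∣det : ∀ {Λ e₁ e₂} → IsBasis Λ e₁ e₂ → (∀ α → (∀ x → Λ x → Λ (α ⋆ x)) → InOrder f α) → + f ∣ det e₁ e₂
    f∣det {Λ} {e₁} {e₂} basis Ord⊆O_f =
      Ord⊆O_f (0ℤ + det e₁ e₂ ω) (λ x _ → subst Λ (sym (detω-⋆ (det e₁ e₂) x)) (det·-∈ basis ((0ℤ + 1ℤ ω) ⋆ x)))
      where
      detω-⋆ : ∀ d x → (0ℤ + d ω) ⋆ x ≡ d · ((0ℤ + 1ℤ ω) ⋆ x)
      detω-⋆ d x = OK-≡ (reScale d (re x) (im x) t n) (imScale d (re x) (im x) t n)
        where
        reScale : ∀ d a b t n → 0ℤ * a - d * b * n ≡ d * (0ℤ * a - 1ℤ * b * n)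
        reScale = solve-∀
        imScale : ∀ d a b t n → 0ℤ * b + d * a + d * b * t ≡ d * (0ℤ * b + 1ℤ * a + 1ℤ * b * t)
        imScale = solve-∀

    form-unimodular : ∀ {e₁ e₂} → Coprime t n e₁ e₂ → + f ∣ det e₁ e₂ →
                      Unimodular₄ (NormForm.A e₁ e₂) (NormForm.B e₁ e₂) (NormForm.C e₁ e₂) (+ f)
    form-unimodular {e₁} {e₂} (X , Y , Xe₁+Ye₂≡1) (divides δ det≡δf) =
      nrm X , trace Q , nrm Y , - (δ * W) , (begin
        nrm X * A + trace Q * B + nrm Y * C + - (δ * W) * + f
          ≡⟨ cong (λ z → nrm X * A + trace Q * B + nrm Y * C + z) (moveFactor δ W (+ f)) ⟩
        nrm X * A + trace Q * B + nrm Y * C + - (δ * + f) * W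
          ≡⟨ cong (λ k → nrm X * A + trace Q * B + nrm Y * C + k * W) (sym im≡-δf) ⟩
        nrm X * A + trace Q * B + nrm Y * C + im (e₁ ⋆ conj e₂) * W
          ≡⟨ sym (nrm-⋆-combination X Y) ⟩
        nrm (X ⋆ e₁ +K Y ⋆ e₂)
          ≡⟨ cong nrm Xe₁+Ye₂≡1 ⟩
        nrm oneK
          ≡⟨ nrm-one t n ⟩
        1ℤ ∎)
      where
      open NormForm e₁ e₂
      Q = X ⋆ conj Y
      W = t * re Q - (n + n) * im Q + t * t * im Q
      im≡-δf : im (e₁ ⋆ conj e₂) ≡ - (δ * + f)
      im≡-δf = trans im-⋆conj (cong -_ det≡δf)
      moveFactor : ∀ δ W F → - (δ * W) * F ≡ - (δ * F) * W
      moveFactor = solve-∀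
      nrm-one : ∀ t n → 1ℤ * 1ℤ + t * 1ℤ * 0ℤ + n * 0ℤ * 0ℤ ≡ 1ℤ
      nrm-one = solve-∀

    coprime-norm : .{{NonZero f}} → ∀ {e₁ e₂} → Coprime t n e₁ e₂ → + f ∣ det e₁ e₂ →
                  Σ[ s ∈ ℤ ] BézoutCoprime (nrm (lincomb e₁ e₂ 1ℤ s)) (+ f)
    coprime-norm {e₁} {e₂} coprime f∣Δ =
      fromForm (coprime-value A B C T f (∣-resp-≡ (sym AC-B²) (∣m⇒∣m*n _ f∣im)) (∣-resp-≡ (sym T-2B) (∣n⇒∣m*n t f∣im))
                              (form-unimodular coprime f∣Δ))
      where
      open NormForm e₁ e₂
      f∣im : + f ∣ im (e₁ ⋆ conj e₂)
      f∣im = ∣-resp-≡ (sym im-⋆conj) (∣m⇒∣-m f∣Δ)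
      fromForm : Σ[ s ∈ ℤ ] BézoutCoprime (A + s * T + s * s * C) (+ f) →
                 Σ[ s ∈ ℤ ] BézoutCoprime (nrm (lincomb e₁ e₂ 1ℤ s)) (+ f)
      fromForm (s , coprime) = s , subst (λ N → BézoutCoprime N (+ f)) (sym (nrm-lincomb s)) coprime

    unit-of-coprime-norm : ∀ {u v} w → u * nrm w + v * + f ≡ 1ℤ → w ⋆ (u · conj w) ≡ᴷ oneK [mod f ]
    unit-of-coprime-norm {u} {v} w uN+vf≡1 = subst (_≡ᴷ oneK [mod f ]) (sym (⋆-·conj u w))
      ( divides (- v) (trans (cong (λ z → u * nrm w - z) (sym uN+vf≡1)) (cancel (u * nrm w) v (+ f)))
      , ∣0 (+ f))
      where
      cancel : ∀ a v f → a - (a + v * f) ≡ - v * f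
      cancel = solve-∀

    ≡ᴷ-by-conj : ∀ {u v} x w → u * nrm w + v * + f ≡ 1ℤ → + f ∣ im (x ⋆ conj w) →
                 x ≡ᴷ (u * re (x ⋆ conj w)) · w [mod f ]
    ≡ᴷ-by-conj {u} {v} x w uN+vf≡1 f∣im =
        cancel-invertible (re x) (nrm w) (re (x ⋆ conj w)) (re w) {u} {v} uN+vf≡1
          (∣-resp-≡ (sym (proj₁ (⋆conj-⋆ x w))) (∣m⇒∣m*n _ f∣im))
      , cancel-invertible (im x) (nrm w) (re (x ⋆ conj w)) (im w) {u} {v} uN+vf≡1
          (∣-resp-≡ (sym (proj₂ (⋆conj-⋆ x w))) (∣m⇒∣m*n _ f∣im))

    reduction : ∀ {Λ e₁ e₂ s u v} → IsBasis Λ e₁ e₂ → + f ∣ det e₁ e₂ → (∀ z → Λ (+ f · z)) →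
                u * nrm (lincomb e₁ e₂ 1ℤ s) + v * + f ≡ 1ℤ → ReducesTo f Λ (lincomb e₁ e₂ 1ℤ s)
    reduction {Λ} {e₁} {e₂} {s} {u} {v} basis f∣Δ fOK⊆ uN+vf≡1 x = Λ⊆ x , ⊆Λ x
      where
      w = lincomb e₁ e₂ 1ℤ s
      lincomb∈ : ∀ p q → Multiples f w (lincomb e₁ e₂ p q)
      lincomb∈ p q = u * re (lincomb e₁ e₂ p q ⋆ conj w) , ≡ᴷ-by-conj {u} {v} (lincomb e₁ e₂ p q) w uN+vf≡1
                           (∣-resp-≡ (sym (NormForm.im-lincomb⋆conj e₁ e₂ p q s)) (∣n⇒∣m*n (q - p * s) f∣Δ))
      Λ⊆ : ∀ x → Λ x → Multiples f w x
      Λ⊆ x x∈Λ with p , q , x≡pq ← basis-coords basis x∈Λ = subst (Multiples f w) (sym x≡pq) (lincomb∈ p q)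
      ⊆Λ : ∀ x → Multiples f w x → Λ x
      ⊆Λ x x∈ with γ , m , x≡ ← proj₂ (fOK+βℤ≐Multiples f w x) x∈ =
        subst Λ (sym x≡) (lattice-+ basis (fOK⊆ γ) (lattice-· basis m (basis-lincomb basis 1ℤ s)))

    to-unit : .{{NonZero f}} → (Λ : PrimevalLattice t n f) → Σ[ β ∈ UnitMod t n f ] ReducesTo f (proj₁ Λ) (proj₁ β)
    to-unit (Λ , (e₁ , e₂ , basis , coprime) , ord) = fromNorm (coprime-norm coprime f∣Δ)
      where
      f∣Δ : + f ∣ det e₁ e₂
      f∣Δ = f∣det basis (λ α → proj₁ (ord α))
      fromNorm : Σ[ s ∈ ℤ ] BézoutCoprime (nrm (lincomb e₁ e₂ 1ℤ s)) (+ f) →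
                 Σ[ β ∈ UnitMod t n f ] ReducesTo f Λ (proj₁ β)
      fromNorm (s , u , v , uN+vf≡1) =
          (w , u · conj w , unit-of-coprime-norm {u} {v} w uN+vf≡1)
        , reduction {s = s} {u} {v} basis f∣Δ (fOK⊆Λ basis coprime (λ α → proj₂ (ord α))) uN+vf≡1
        where
        w = lincomb e₁ e₂ 1ℤ s

    unit⇒unimodular : ∀ {β} → IsUnitMod t n f β → Unimodular₃ (re β) (im β) (+ f)
    unit⇒unimodular {β} (γ , divides k re-1≡kf , _) = re γ , - (im γ * n) , - k , (begin
      re γ * re β + - (im γ * n) * im β + - k * + f ≡⟨ regroup (re β) (im β) (re γ) (im γ) n k (+ f) ⟩
      re (β ⋆ γ) - k * + f                          ≡⟨ cong (λ z → re (β ⋆ γ) - z) (sym re-1≡kf) ⟩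
      re (β ⋆ γ) - (re (β ⋆ γ) - 1ℤ)                ≡⟨ cancel (re (β ⋆ γ)) ⟩
      1ℤ                                            ∎)
      where
      regroup : ∀ p q g₀ g₁ n k F → g₀ * p + - (g₁ * n) * q + - k * F ≡ (p * g₀ - q * g₁ * n) - k * F
      regroup = solve-∀
      cancel : ∀ r → r - (r - 1ℤ) ≡ 1ℤ
      cancel = solve-∀

    -- β′ ≡ β mod fO_K has coprime coordinates, so (β′, ρ) is a ℤ-basis of O_K (determinant u p′ + v q′ = 1).
    module Translation (β : OK) (μ₀ μ₁ u v : ℤ) (det≡1 : u * (re β + μ₀ * + f) + v * (im β + μ₁ * + f) ≡ 1ℤ) where

      F p q p′ q′ : ℤ
      F = + f
      p = re β
      q = im β
      p′ = p + μ₀ * F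
      q′ = q + μ₁ * F

      β′ ρ : OK
      β′ = p′ + q′ ω
      ρ = (- v) + u ω

      independent : .{{NonZero f}} → LinIndep β′ (F · ρ)
      independent a b combination≡0 = a≡0 , b≡0
        where
        re≡0 : a * p′ + b * (F * (- v)) ≡ 0ℤ
        re≡0 = cong re combination≡0
        im≡0 : a * q′ + b * (F * u) ≡ 0ℤ
        im≡0 = cong im combination≡0
        a≡0 : a ≡ 0ℤ
        a≡0 = begin
          a                                                           ≡⟨ sym (ℤ.*-identityʳ a) ⟩
          a * 1ℤ                                                      ≡⟨ cong (a *_) (sym det≡1) ⟩
          a * (u * p′ + v * q′)                                       ≡⟨ eliminate a b p′ q′ u v F ⟩
          u * (a * p′ + b * (F * (- v))) + v * (a * q′ + b * (F * u)) ≡⟨ cong₂ (λ x y → u * x + v * y) re≡0 im≡0 ⟩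
          u * 0ℤ + v * 0ℤ                                             ≡⟨ zeros u v ⟩
          0ℤ                                                          ∎
          where
          eliminate : ∀ a b p′ q′ u v F → a * (u * p′ + v * q′) ≡ u * (a * p′ + b * (F * (- v))) + v * (a * q′ + b * (F * u))
          eliminate = solve-∀
          zeros : ∀ u v → u * 0ℤ + v * 0ℤ ≡ 0ℤ
          zeros = solve-∀
        bF≡0 : b * F ≡ 0ℤ
        bF≡0 = begin
          b * F                                                           ≡⟨ sym (ℤ.*-identityʳ (b * F)) ⟩
          b * F * 1ℤ                                                      ≡⟨ cong (b * F *_) (sym det≡1) ⟩
          b * F * (u * p′ + v * q′)                                       ≡⟨ eliminate a b p′ q′ u v F ⟩
          p′ * (a * q′ + b * (F * u)) - q′ * (a * p′ + b * (F * (- v)))   ≡⟨ cong₂ (λ x y → p′ * x - q′ * y) im≡0 re≡0 ⟩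
          p′ * 0ℤ - q′ * 0ℤ                                               ≡⟨ zeros p′ q′ ⟩
          0ℤ                                                              ∎
          where
          eliminate : ∀ a b p′ q′ u v F → b * F * (u * p′ + v * q′) ≡ p′ * (a * q′ + b * (F * u)) - q′ * (a * p′ + b * (F * (- v)))
          eliminate = solve-∀
          zeros : ∀ p′ q′ → p′ * 0ℤ - q′ * 0ℤ ≡ 0ℤ
          zeros = solve-∀
        b≡0 : b ≡ 0ℤ
        b≡0 = [ id , (λ F≡0 → contradiction (ℤ.+-injective F≡0) (ℕ.≢-nonZero⁻¹ f)) ]′ (ℤ.i*j≡0⇒i≡0∨j≡0 b bF≡0)

      spanned : ∀ x → fOK+βℤ f β x → Σ[ a ∈ ℤ ] Σ[ b ∈ ℤ ] x ≡ lincomb β′ (F · ρ) a b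
      spanned x (γ , m , x≡) = m + F * (u * c₀ + v * c₁) , (- q′) * c₀ + p′ * c₁ , trans x≡ (OK-≡ (sym reCoord) (sym imCoord))
        where
        c₀ = re γ - m * μ₀
        c₁ = im γ - m * μ₁
        reCoord : (m + F * (u * c₀ + v * c₁)) * p′ + ((- q′) * c₀ + p′ * c₁) * (F * (- v)) ≡ F * re γ + m * p
        reCoord = begin
          (m + F * (u * c₀ + v * c₁)) * p′ + ((- q′) * c₀ + p′ * c₁) * (F * (- v)) ≡⟨ expand F c₀ c₁ m p′ q′ u v ⟩
          m * p′ + F * c₀ * (u * p′ + v * q′)                                     ≡⟨ cong (λ z → m * p′ + F * c₀ * z) det≡1 ⟩
          m * p′ + F * c₀ * 1ℤ                                                    ≡⟨ collect F (re γ) m p μ₀ ⟩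
          F * re γ + m * p                                                        ∎
          where
          expand : ∀ F c₀ c₁ m p′ q′ u v → (m + F * (u * c₀ + v * c₁)) * p′ + ((- q′) * c₀ + p′ * c₁) * (F * (- v))
                                         ≡ m * p′ + F * c₀ * (u * p′ + v * q′)
          expand = solve-∀
          collect : ∀ F g m p μ → m * (p + μ * F) + F * (g - m * μ) * 1ℤ ≡ F * g + m * p
          collect = solve-∀
        imCoord : (m + F * (u * c₀ + v * c₁)) * q′ + ((- q′) * c₀ + p′ * c₁) * (F * u) ≡ F * im γ + m * q
        imCoord = begin
          (m + F * (u * c₀ + v * c₁)) * q′ + ((- q′) * c₀ + p′ * c₁) * (F * u) ≡⟨ expand F c₀ c₁ m p′ q′ u v ⟩
          m * q′ + F * c₁ * (u * p′ + v * q′)                                 ≡⟨ cong (λ z → m * q′ + F * c₁ * z) det≡1 ⟩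
          m * q′ + F * c₁ * 1ℤ                                                ≡⟨ collect F (im γ) m q μ₁ ⟩
          F * im γ + m * q                                                    ∎
          where
          expand : ∀ F c₀ c₁ m p′ q′ u v → (m + F * (u * c₀ + v * c₁)) * q′ + ((- q′) * c₀ + p′ * c₁) * (F * u)
                                         ≡ m * q′ + F * c₁ * (u * p′ + v * q′)
          expand = solve-∀
          collect : ∀ F g m q μ → m * (q + μ * F) + F * (g - m * μ) * 1ℤ ≡ F * g + m * q
          collect = solve-∀

      lincomb∈ : ∀ a b → fOK+βℤ f β (lincomb β′ (F · ρ) a b)
      lincomb∈ a b = (a * μ₀ + b * (- v)) + (a * μ₁ + b * u) ω , a , OK-≡ (regroup a b p μ₀ F (- v)) (regroup a b q μ₁ F u)
        where
        regroup : ∀ a b p μ F c → a * (p + μ * F) + b * (F * c) ≡ F * (a * μ + b * c) + a * p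
        regroup = solve-∀

      basis : .{{NonZero f}} → IsBasis (fOK+βℤ f β) β′ (F · ρ)
      basis = independent , λ x → spanned x , λ { (a , b , x≡) → subst (fOK+βℤ f β) (sym x≡) (lincomb∈ a b) }

      -- β′ γ = 1 + f r and u β′ − q′ ρ = 1, so X′ β′ + Y′ (f ρ) = γ β′ − f r (u β′ − q′ ρ) = 1.
      coprime : IsUnitMod t n f β → Coprime t n β′ (F · ρ)
      coprime (γ , divides k₀ re≡ , divides k₁ im≡) = X′ , Y′ , OK-≡
        (trans (reOne p q g₀ g₁ k₀ k₁ μ₀ μ₁ u v F t n)
               (trans (cong₂ (λ y z → 1ℤ + (y - k₀ * F) + F * re r * (1ℤ - z)) re≡ det≡1) (reCancel k₀ F (re r))))
        (trans (imOne p q g₀ g₁ k₀ k₁ μ₀ μ₁ u v F t n)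
               (trans (cong₂ (λ y z → 0ℤ + (y - k₁ * F) + F * im r * (1ℤ - z)) im≡ det≡1) (imCancel k₁ F (im r))))
        where
        g₀ = re γ
        g₁ = im γ
        r = (k₀ + k₁ ω) +K (μ₀ + μ₁ ω) ⋆ γ
        X′ = γ +K ((- (u * F)) · r)
        Y′ = q′ · r
        reOne : ∀ p q g₀ g₁ k₀ k₁ μ₀ μ₁ u v F t n →
          ((g₀ + (- (u * F)) * (k₀ + (μ₀ * g₀ - μ₁ * g₁ * n))) * (p + μ₀ * F)
             - (g₁ + (- (u * F)) * (k₁ + (μ₀ * g₁ + μ₁ * g₀ + μ₁ * g₁ * t))) * (q + μ₁ * F) * n)
          + ((q + μ₁ * F) * (k₀ + (μ₀ * g₀ - μ₁ * g₁ * n)) * (F * (- v))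
             - (q + μ₁ * F) * (k₁ + (μ₀ * g₁ + μ₁ * g₀ + μ₁ * g₁ * t)) * (F * u) * n)
          ≡ 1ℤ + ((p * g₀ - q * g₁ * n) - 1ℤ - k₀ * F)
            + F * (k₀ + (μ₀ * g₀ - μ₁ * g₁ * n)) * (1ℤ - (u * (p + μ₀ * F) + v * (q + μ₁ * F)))
        reOne = solve-∀
        imOne : ∀ p q g₀ g₁ k₀ k₁ μ₀ μ₁ u v F t n →
          ((g₀ + (- (u * F)) * (k₀ + (μ₀ * g₀ - μ₁ * g₁ * n))) * (q + μ₁ * F)
             + (g₁ + (- (u * F)) * (k₁ + (μ₀ * g₁ + μ₁ * g₀ + μ₁ * g₁ * t))) * (p + μ₀ * F)
             + (g₁ + (- (u * F)) * (k₁ + (μ₀ * g₁ + μ₁ * g₀ + μ₁ * g₁ * t))) * (q + μ₁ * F) * t)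
          + ((q + μ₁ * F) * (k₀ + (μ₀ * g₀ - μ₁ * g₁ * n)) * (F * u)
             + (q + μ₁ * F) * (k₁ + (μ₀ * g₁ + μ₁ * g₀ + μ₁ * g₁ * t)) * (F * (- v))
             + (q + μ₁ * F) * (k₁ + (μ₀ * g₁ + μ₁ * g₀ + μ₁ * g₁ * t)) * (F * u) * t)
          ≡ 0ℤ + ((p * g₁ + q * g₀ + q * g₁ * t) - 0ℤ - k₁ * F)
            + F * (k₁ + (μ₀ * g₁ + μ₁ * g₀ + μ₁ * g₁ * t)) * (1ℤ - (u * (p + μ₀ * F) + v * (q + μ₁ * F)))
        imOne = solve-∀
        reCancel : ∀ k F e → 1ℤ + (k * F - k * F) + F * e * (1ℤ - 1ℤ) ≡ 1ℤ
        reCancel = solve-∀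
        imCancel : ∀ k F e → 0ℤ + (k * F - k * F) + F * e * (1ℤ - 1ℤ) ≡ 0ℤ
        imCancel = solve-∀

    -- (α − m) β ∈ fO_K, hence (α − m) β γ ∈ fO_K, and β γ ≡ 1 then gives α ≡ m modulo fO_K.
    fOK+βℤ-order : ∀ {β} → IsUnitMod t n f β → OrdIs t n f (fOK+βℤ f β)
    fOK+βℤ-order {β} (γ , divides k₀ re≡ , divides k₁ im≡) α = stabilizer⊆O_f , O_f⊆stabilizer
      where
      F = + f
      p = re β
      q = im β
      β∈ : fOK+βℤ f β β
      β∈ = zeroK , 1ℤ , OK-≡ (identity p F) (identity q F)
        where
        identity : ∀ p F → p ≡ F * 0ℤ + 1ℤ * p
        identity = solve-∀

      im≡m-mod : fOK+βℤ f β (α ⋆ β) → + f ∣ im α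
      im≡m-mod (h , m , αβ≡) = ∣-resp-≡ (sym (imδ d₀ d₁ z₀ z₁ t n)) (∣m∣n⇒∣m-n f∣im[δβγ] f∣rest)
        where
        d₀ = re α - m
        d₁ = im α
        δ = d₀ + d₁ ω
        z₀ = re (β ⋆ γ)
        z₁ = im (β ⋆ γ)
        reδβ : re (δ ⋆ β) ≡ re h * F
        reδβ = trans (expand (re α) (im α) m p q n) (trans (cong (_- m * p) (cong re αβ≡)) (cancel F (re h) m p))
          where
          expand : ∀ a₀ a₁ m p q n → (a₀ - m) * p - a₁ * q * n ≡ (a₀ * p - a₁ * q * n) - m * p
          expand = solve-∀
          cancel : ∀ F g m p → F * g + m * p - m * p ≡ g * F
          cancel = solve-∀
        imδβ : im (δ ⋆ β) ≡ im h * F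
        imδβ = trans (expand (re α) (im α) m p q t) (trans (cong (_- m * q) (cong im αβ≡)) (cancel F (im h) m q))
          where
          expand : ∀ a₀ a₁ m p q t → (a₀ - m) * q + a₁ * p + a₁ * q * t ≡ (a₀ * q + a₁ * p + a₁ * q * t) - m * q
          expand = solve-∀
          cancel : ∀ F g m q → F * g + m * q - m * q ≡ g * F
          cancel = solve-∀
        f∣im[δβγ] : + f ∣ im (δ ⋆ (β ⋆ γ))
        f∣im[δβγ] = subst (λ z → + f ∣ im z) (⋆-assoc δ β γ) (proj₂ (∣-⋆ (δ ⋆ β) γ (divides (re h) reδβ) (divides (im h) imδβ)))
        f∣z₁ : + f ∣ z₁
        f∣z₁ = divides k₁ (trans (sym (ℤ.+-identityʳ z₁)) im≡)
        f∣rest : + f ∣ d₀ * z₁ + d₁ * (z₀ - 1ℤ) + d₁ * z₁ * t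
        f∣rest = ∣m∣n⇒∣m+n (∣-linear d₀ d₁ f∣z₁ (divides k₀ re≡)) (∣m⇒∣m*n t (∣n⇒∣m*n d₁ f∣z₁))
        imδ : ∀ d₀ d₁ z₀ z₁ t n → d₁ ≡ (d₀ * z₁ + d₁ * z₀ + d₁ * z₁ * t) - (d₀ * z₁ + d₁ * (z₀ - 1ℤ) + d₁ * z₁ * t)
        imδ = solve-∀

      stabilizer⊆O_f : (∀ x → fOK+βℤ f β x → fOK+βℤ f β (α ⋆ x)) → InOrder f α
      stabilizer⊆O_f stabilizes = im≡m-mod (stabilizes β β∈)

      O_f⊆stabilizer : InOrder f α → ∀ x → fOK+βℤ f β x → fOK+βℤ f β (α ⋆ x)
      O_f⊆stabilizer (divides k im≡kF) x (h , m , x≡) =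
        _ , m * re α , trans (cong₂ _⋆_ (OK-≡ {α} refl im≡kF) x≡) (OK-≡ (reDistribute (re α) k F (re h) (im h) m p q t n)
                                                                          (imDistribute (re α) k F (re h) (im h) m p q t n))
        where
        reDistribute : ∀ a₀ k F h₀ h₁ m p q t n →
          a₀ * (F * h₀ + m * p) - k * F * (F * h₁ + m * q) * n
          ≡ F * ((a₀ * h₀ - k * F * h₁ * n) + m * k * (0ℤ * p - 1ℤ * q * n)) + m * a₀ * p
        reDistribute = solve-∀
        imDistribute : ∀ a₀ k F h₀ h₁ m p q t n →
          a₀ * (F * h₁ + m * q) + k * F * (F * h₀ + m * p) + k * F * (F * h₁ + m * q) * t
          ≡ F * ((a₀ * h₁ + k * F * h₀ + k * F * h₁ * t) + m * k * (0ℤ * q + 1ℤ * p + 1ℤ * q * t)) + m * a₀ * q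
        imDistribute = solve-∀

    fOK+βℤ-primeval : .{{NonZero f}} → ∀ {β} → IsUnitMod t n f β → Primeval t n f (fOK+βℤ f β)
    fOK+βℤ-primeval {β} unit = fromTranslate (coprime-translate (re β) (im β) (+ f) (unit⇒unimodular unit))
      where
      fromTranslate : Σ[ μ₀ ∈ ℤ ] Σ[ μ₁ ∈ ℤ ] BézoutCoprime (re β + μ₀ * + f) (im β + μ₁ * + f) →
                      Primeval t n f (fOK+βℤ f β)
      fromTranslate (μ₀ , μ₁ , u , v , det≡1) = (β′ , F · ρ , basis , coprime unit) , fOK+βℤ-order unit
        where
        open Translation β μ₀ μ₁ u v det≡1

    -- From w ≡ m′ m w and w γ ≡ 1 we get (1 − m′ m) ≡ 0, so m is a unit modulo f.
    Multiples-≐⇒~ : ∀ {w w′} → IsUnitMod t n f w → Multiples f w ≐ Multiples f w′ → w ~[ f ] w′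
    Multiples-≐⇒~ {w} {w′} (γ , wγ≡1) w≐w′ =
      fromMultiples (proj₂ (w≐w′ w′) (1ℤ , ≡-scaled-refl (re w′) , ≡-scaled-refl (im w′)))
                    (proj₁ (w≐w′ w) (1ℤ , ≡-scaled-refl (re w) , ≡-scaled-refl (im w)))
      where
      fromMultiples : Multiples f w w′ → Multiples f w′ w → w ~[ f ] w′
      fromMultiples (m , re≡ , im≡) (m′ , re≡′ , im≡′) = m , (m′ , f∣mm′-1) , re≡ , im≡
        where
        a = m′ * m
        re≡a : + f ∣ re w - a * re w
        re≡a = ≡-scaled-trans (re w) (re w′) (re w) m′ m re≡′ re≡
        im≡a : + f ∣ im w - a * im w
        im≡a = ≡-scaled-trans (im w) (im w′) (im w) m′ m im≡′ im≡
        f∣[1-a]wγ : + f ∣ (1ℤ - a) * re (w ⋆ γ)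
        f∣[1-a]wγ = ∣-resp-≡ (factor (re w) (im w) (re γ) (im γ) a n)
          (∣m∣n⇒∣m-n (∣m⇒∣m*n (re γ) re≡a) (∣m⇒∣m*n n (∣m⇒∣m*n (im γ) im≡a)))
          where
          factor : ∀ w₀ w₁ g₀ g₁ a n → (w₀ - a * w₀) * g₀ - (w₁ - a * w₁) * g₁ * n ≡ (1ℤ - a) * (w₀ * g₀ - w₁ * g₁ * n)
          factor = solve-∀
        f∣mm′-1 : + f ∣ m * m′ - 1ℤ
        f∣mm′-1 = ∣-resp-≡ (sym (split m m′ (re (w ⋆ γ)))) (∣m∣n⇒∣m-n (∣n⇒∣m*n (1ℤ - a) (proj₁ wγ≡1)) f∣[1-a]wγ)
          where
          split : ∀ m m′ r → m * m′ - 1ℤ ≡ (1ℤ - m′ * m) * (r - 1ℤ) - (1ℤ - m′ * m) * r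
          split = solve-∀

    primeval-bijection : .{{NonZero f}} → Inverse (LatticeSetoid t n f) (UnitQuotSetoid t n f)
    primeval-bijection = record
      { to        = λ Λ → proj₁ (to-unit Λ)
      ; from      = λ β → fOK+βℤ f (proj₁ β) , fOK+βℤ-primeval (proj₂ β)
      ; to-cong   = λ {Λ} {Λ′} Λ≐Λ′ →
                      Multiples-≐⇒~ (unitOf Λ) (≐-trans (≐-sym (reduces Λ)) (≐-trans Λ≐Λ′ (reduces Λ′)))
      ; from-cong = λ {β} {β′} β~β′ →
                      ≐-trans (fOK+βℤ≐Multiples f (proj₁ β))
                              (≐-trans (~⇒Multiples-≐ β~β′) (≐-sym (fOK+βℤ≐Multiples f (proj₁ β′))))
      ; inverse   = (λ {β} {Λ} Λ≐fOK+βℤ → Multiples-≐⇒~ (unitOf Λ)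
                      (≐-trans (≐-sym (reduces Λ)) (≐-trans Λ≐fOK+βℤ (fOK+βℤ≐Multiples f (proj₁ β)))))
                  , (λ {Λ} {β} β~ → ≐-trans (fOK+βℤ≐Multiples f (proj₁ β))
                                            (≐-trans (~⇒Multiples-≐ β~) (≐-sym (reduces Λ))))
      }
      where
      unitOf : (Λ : PrimevalLattice t n f) → IsUnitMod t n f (proj₁ (proj₁ (to-unit Λ)))
      unitOf Λ = proj₂ (proj₁ (to-unit Λ))
      reduces : (Λ : PrimevalLattice t n f) → ReducesTo f (proj₁ Λ) (proj₁ (proj₁ (to-unit Λ)))
      reduces Λ = proj₂ (to-unit Λ)

proposition6p3 : (t n : ℤ) → IsFundamentalDiscriminant (t * t - + 4 * n) → (t * t - + 4 * n) < 0ℤ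
    → (f : ℕ) → 0 <ℕ f
    → Σ[ F ∈ Inverse (LatticeSetoid t n f) (UnitQuotSetoid t n f) ]
    (((Λ : PrimevalLattice t n f) → ReducesTo f (proj₁ Λ) (proj₁ (Inverse.to F Λ)))
    × ((β : UnitMod t n f) → proj₁ (Inverse.from F β) ≐ fOK+βℤ f (proj₁ β)))
proposition6p3 t n _ _ f 0<f =
  primeval-bijection t n f , (λ Λ → proj₂ (to-unit t n f Λ)) , (λ β x → id , id)
  where
  instance
    f≢0 : NonZero f
    f≢0 = ℕ.>-nonZero 0<f
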